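{- Let $S$ be any suffix of $T$, spelled by the root-to-sink path $\pi=(f_1,\dots,f_\ell)$. (1) $S$ is $(-)$-canonical if and only if $S$ is $(+)$-canonical. (2) If $S$ is canonical and $k_-$, $k_+$ are the indexes in $\pi$ of its $(-)$- and $(+)$-certificates, respectively (with the convention that the imaginary certificate $f^\bot_+$ has index $0$ and $f^\bot_-$ has index $\ell+1$), then $k_+\le k_-$; in particular, if both certificates are real edges of $\pi$, then $1\le k_+\le k_-\le\ell$.
   Context: Let $T=T[1..n]$ be a text over an integer alphabet with total order, ending with a unique smallest end-marker $\$$. $\le_{\mathrm{lex}}$ is lexicographic order; $X\le_{\mathrm{pos}}Y$ iff $|X|\ge|Y|$. The CDAWG $G$ of $T$ is the edge-labeled DAG obtained from the suffix tree of $T$ by merging isomorphic subtrees; it has a root and a sink, edges with nonempty labels, outgoing edges of a node start with distinct symbols, and spelling root-to-sink paths is a bijection onto the suffixes of $T$; $E$ is its edge set. For a node $v$, $N_-(v)$/$N_+(v)$ are incoming/outgoing edges, $U_-(v)$ the strings spelled by root-to-$v$ paths, $U_+(v)$ those spelled by $v$-to-sink paths. Fix $\preceq_-=\le_{\mathrm{pos}}$, $\preceq_+\in\{\le_{\mathrm{lex}},\le_{\mathrm{pos}}\}$, and $\mathrm{repr}_\delta(v)=\min_{\preceq_\delta}U_\delta(v)$ (strings identified with their unique paths). An edge of $N_-(v)$ is $(-)$-primary if it is the last edge of the path of $\mathrm{repr}_-(v)$; an edge of $N_+(v)$ is $(+)$-primary if it is the first edge of the path of $\mathrm{repr}_+(v)$;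 $EP_\delta$ = $\delta$-primary edges, $ES_\delta=E\setminus EP_\delta$. $f^\bot_-$, $f^\bot_+$ are imaginary edges not in $E$. $S$ (path $(f_1,\dots,f_\ell)$) is $\delta$-trivial if all $f_i\in EP_\delta$. A $(-)$-canonical factoring at $k\in[\ell]$: $f_1,\dots,f_{k-1}\in EP_-$, $f_k\in ES_-$, $f_{k+1},\dots,f_\ell\in EP_+$; a $(+)$-canonical factoring at $k$: $f_1,\dots,f_{k-1}\in EP_-$, $f_k\in ES_+$, $f_{k+1},\dots,f_\ell\in EP_+$. $S$ is $\delta$-canonical if it is $\delta$-trivial (then its $\delta$-certificate is $f^\bot_\delta$) or has a $\delta$-canonical factoring at $k$ (then its $\delta$-certificate is $f_k$). $S$ is canonical if it is $(-)$- or $(+)$-canonical. -}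

module Defs where

open import Data.Nat using (ℕ; zero; suc; _≤_; _<_)
open import Data.List using (List; []; _∷_; _++_; [_]; length; concatMap)
open import Data.List.Relation.Unary.All using (All)
open import Data.List.Relation.Binary.Lex.Strict using (Lex-≤)
open import Data.Product using (Σ; ∃; ∃-syntax; _×_; _,_; proj₁; proj₂)
open import Data.Sum using (_⊎_)
open import Relation.Nullary using (¬_)
open import Relation.Binary.PropositionalEquality using (_≡_; _≢_)

Str : Set
Str = List ℕ

EndMarked : Str → Set
EndMarked T = ∃[ T′ ] ∃[ d ] (T ≡ T′ ++ [ d ] × All (d <_) T′)

RightMaximal : Str → Str → Set
RightMaximal T x =
  ∃[ u₁ ] ∃[ a ] ∃[ w₁ ] ∃[ u₂ ] ∃[ b ] ∃[ w₂ ]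
    (u₁ ++ x ++ a ∷ w₁ ≡ T × u₂ ++ x ++ b ∷ w₂ ≡ T × a ≢ b)

LeftMaximal : Str → Str → Set
LeftMaximal T x =
  (∃[ w ] (x ++ w ≡ T))
  ⊎ (∃[ u₁ ] ∃[ a ] ∃[ w₁ ] ∃[ u₂ ] ∃[ b ] ∃[ w₂ ]
       (u₁ ++ a ∷ x ++ w₁ ≡ T × u₂ ++ b ∷ x ++ w₂ ≡ T × a ≢ b))

-- A node is identified with the longest string of its
-- class (the longest element of U₋(v)):  the root is ε, the sink is T
-- (the class of all leaves of the suffix tree), and the internal nodes
-- are the maximal repeats of T (right-maximal and left-maximal).

IsNode : Str → Str → Set
IsNode T x = x ≡ [] ⊎ x ≡ T ⊎ (RightMaximal T x × LeftMaximal T x)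

-- An edge (x , lab , y):  in the suffix tree, the edge out of the locus
-- of x labelled lab (nonempty) leads to the locus of x ++ lab, i.e.
-- x ++ lab is a substring that is right-maximal or a suffix of T (leaf),
-- and no shorter nonempty prefix p of lab makes x ++ p right-maximal.
-- Merging isomorphic subtrees, the target is the node y of the class of
-- x ++ lab: x ++ lab is a suffix of y and every occurrence of x ++ lab
-- extends to an occurrence of y ending at the same position.
Edge : Set
Edge = Str × Str × Str

src lab tgt : Edge → Str
src (x , _ , _) = x
lab (_ , l , _) = l
tgt (_ , _ , y) = y

IsEdge : Str → Edge → Set
IsEdge T (x , l , y) =
  IsNode T x × IsNode T y
  × (∃[ c ] ∃[ β ] (l ≡ c ∷ β))
  × (∃[ u ] ∃[ w ] (u ++ (x ++ l) ++ w ≡ T))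
  × (RightMaximal T (x ++ l) ⊎ ∃[ u ] (u ++ x ++ l ≡ T))
  × (∀ p q → l ≡ p ++ q → p ≢ [] → q ≢ [] → ¬ RightMaximal T (x ++ p))
  × (∃[ α ] (y ≡ α ++ x ++ l))
  × (∀ u w → u ++ (x ++ l) ++ w ≡ T → ∃[ u′ ] (u′ ++ y ++ w ≡ T))

_∈E_ : Edge → Str → Set
e ∈E T = IsEdge T e

root : Str
root = []

sink : Str → Str
sink T = T

Linked : Str → Str → List Edge → Set
Linked v w []      = v ≡ w
Linked v w (e ∷ π) = src e ≡ v × Linked (tgt e) w π

PathFromTo : Str → Str → Str → List Edge → Set
PathFromTo T v w π = All (_∈E T) π × Linked v w π

spell : List Edge → Str
spell = concatMap lab

U₋ : Str → Str → Str → Set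
U₋ T v X = ∃[ π ] (PathFromTo T root v π × spell π ≡ X)

U₊ : Str → Str → Str → Set
U₊ T v X = ∃[ π ] (PathFromTo T v (sink T) π × spell π ≡ X)

_≤pos_ : Str → Str → Set
X ≤pos Y = length Y ≤ length X

-- lexicographic order (a proper prefix is smaller).
_≤lex_ : Str → Str → Set
_≤lex_ = Lex-≤ _≡_ _<_

-- the two admissible choices of ⪯₊
data PlusOrder : Set where
  lexOrd posOrd : PlusOrder

⟦_⟧ : PlusOrder → Str → Str → Set
⟦ lexOrd ⟧ = _≤lex_
⟦ posOrd ⟧ = _≤pos_

IsMin : (Str → Str → Set) → (Str → Set) → Str → Set
IsMin _⪯_ P X = P X × (∀ Y → P Y → X ⪯ Y)

-- Primary / secondary edges.  ⪯₋ = ≤pos.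

EP₋ : Str → Edge → Set
EP₋ T e = e ∈E T
  × ∃[ π ] (PathFromTo T root (tgt e) (π ++ [ e ])
            × IsMin _≤pos_ (U₋ T (tgt e)) (spell (π ++ [ e ])))

EP₊ : PlusOrder → Str → Edge → Set
EP₊ o T e = e ∈E T
  × ∃[ π ] (PathFromTo T (src e) (sink T) (e ∷ π)
            × IsMin ⟦ o ⟧ (U₊ T (src e)) (spell (e ∷ π)))

ES₋ : Str → Edge → Set
ES₋ T e = e ∈E T × ¬ EP₋ T e

ES₊ : PlusOrder → Str → Edge → Set
ES₊ o T e = e ∈E T × ¬ EP₊ o T e

-- Certificates, given by their index in π = (f₁,…,f_ℓ).
-- Index convention: f^⊥₋ has index ℓ+1, f^⊥₊ has index 0, and a real
-- certificate f_k has index k ∈ [1,ℓ].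

MinusCert : PlusOrder → Str → List Edge → ℕ → Set
MinusCert o T π k =
  (All (EP₋ T) π × k ≡ suc (length π))
  ⊎ (∃[ α ] ∃[ f ] ∃[ β ]
       (π ≡ α ++ f ∷ β × k ≡ suc (length α)
        × All (EP₋ T) α × ES₋ T f × All (EP₊ o T) β))

PlusCert : PlusOrder → Str → List Edge → ℕ → Set
PlusCert o T π k =
  (All (EP₊ o T) π × k ≡ 0)
  ⊎ (∃[ α ] ∃[ f ] ∃[ β ]
       (π ≡ α ++ f ∷ β × k ≡ suc (length α)
        × All (EP₋ T) α × ES₊ o T f × All (EP₊ o T) β))

MinusCanonical PlusCanonical : PlusOrder → Str → List Edge → Set
MinusCanonical o T π = ∃[ k ] MinusCert o T π k
PlusCanonical  o T π = ∃[ k ] PlusCert o T π k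

-- A (−)-factoring of a path can only split at its first edge that is not
-- (−)-primary, and a (+)-factoring only at its last edge that is not
-- (+)-primary.  So the path is (−)-canonical iff every edge after the first
-- non-(−)-primary one is (+)-primary, and (+)-canonical iff every edge
-- before the last non-(+)-primary one is (−)-primary: both say that the
-- last non-(+)-primary edge does not come after the first non-(−)-primary
-- one, and this is k₊ ≤ k₋.
--
-- To find these two edges constructively, primality is decided by
-- exhaustive search: nodes and edge labels are substrings of T, and a path
-- has at most |T| edges since every edge strictly lengthens its node.

module Submission where

open import Defs
open import Data.Nat using (ℕ; _≤_)
open import Data.List using (List; _++_; length)
open import Data.Product using (∃-syntax; _×_)
open import Function.Bundles using (_⇔_)
open import Relation.Binary.PropositionalEquality using (_≡_)

open import Data.Nat using (zero; suc; _+_; _<_; z≤n; s≤s; _≟_; _<?_; _≤?_)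
open import Data.Nat.Properties
  using (≤-refl; ≤-trans; module ≤-Reasoning; +-suc; +-monoʳ-≤; m≤m+n; n≤1+n)
open import Data.List using ([]; _∷_; [_]; map; concatMap; inits; tails; cartesianProduct)
open import Data.List.Properties
  using ( ++-assoc; ++-identityʳ; ∷-injectiveˡ; ∷-injectiveʳ
        ; length-++-≤ˡ; length-++-≤ʳ; length-++-sucʳ)
  renaming (≡-dec to List-≡-dec)
open import Data.List.Relation.Unary.All as All using (All; []; _∷_)
open import Data.List.Relation.Unary.All.Properties using (++⁻ˡ; ++⁻ʳ)
open import Data.List.Relation.Unary.Any as Any using (here; there)
open import Data.List.Membership.Propositional using (_∈_; _∉_)
open import Data.List.Membership.Propositional.Properties
  using (∈-map⁺; ∈-concat⁺′; ∈-cartesianProduct⁺; ∈-++⁺ʳ)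
import Data.List.Relation.Binary.Lex.Strict as Lex
open import Data.Product using (∃; _,_)
open import Data.Product.Properties using () renaming (≡-dec to ×-≡-dec)
open import Data.Sum using (_⊎_; inj₁; inj₂)
open import Data.Empty using (⊥-elim)
open import Function.Bundles using (mk⇔)
open import Relation.Nullary using (¬_; Dec; yes; no)
open import Relation.Nullary.Decidable using (_×-dec_; _⊎-dec_; _→-dec_; ¬?; map′)
open import Relation.Unary using (Decidable)
open import Relation.Binary.Definitions using (DecidableEquality)
open import Relation.Binary.PropositionalEquality using (_≢_; refl; sym; trans; cong; subst)

module _ {X : Set} {P : X → Set} where

  All-middle : ∀ α {f} β → All P (α ++ f ∷ β) → P f
  All-middle α β ps = All.head (++⁻ʳ α ps)

  first-failure : Decidable P → ∀ π →
    All P π ⊎ ∃[ α ] ∃[ f ] ∃[ β ] (π ≡ α ++ f ∷ β × All P α × ¬ P f)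
  first-failure P? [] = inj₁ []
  first-failure P? (g ∷ π) with P? g | first-failure P? π
  ... | no ¬pg | _ = inj₂ ([] , g , π , refl , [] , ¬pg)
  ... | yes pg | inj₁ ps = inj₁ (pg ∷ ps)
  ... | yes pg | inj₂ (α , f , β , refl , pα , ¬pf) = inj₂ (g ∷ α , f , β , refl , pg ∷ pα , ¬pf)

  last-failure : Decidable P → ∀ π →
    All P π ⊎ ∃[ α ] ∃[ f ] ∃[ β ] (π ≡ α ++ f ∷ β × ¬ P f × All P β)
  last-failure P? [] = inj₁ []
  last-failure P? (g ∷ π) with last-failure P? π | P? g
  ... | inj₂ (α , f , β , refl , ¬pf , pβ) | _ = inj₂ (g ∷ α , f , β , refl , ¬pf , pβ)
  ... | inj₁ ps | yes pg = inj₁ (pg ∷ ps)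
  ... | inj₁ ps | no ¬pg = inj₂ ([] , g , π , refl , ¬pg , ps)

  module _ {f f′ : X} where

    All-prefix-≤-failure : ∀ α β α′ β′ → α ++ f ∷ β ≡ α′ ++ f′ ∷ β′ →
      All P α′ → ¬ P f → length α′ ≤ length α
    All-prefix-≤-failure α       β []       β′ eq pα′ ¬pf = z≤n
    All-prefix-≤-failure []      β (g ∷ α′) β′ refl (pg ∷ _) ¬pf = ⊥-elim (¬pf pg)
    All-prefix-≤-failure (_ ∷ α) β (_ ∷ α′) β′ eq (_ ∷ pα′) ¬pf =
      s≤s (All-prefix-≤-failure α β α′ β′ (∷-injectiveʳ eq) pα′ ¬pf)

    failure-≤-All-suffix : ∀ α β α′ β′ → α ++ f ∷ β ≡ α′ ++ f′ ∷ β′ →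
      All P β → ¬ P f′ → length α′ ≤ length α
    failure-≤-All-suffix α       β []       β′ eq pβ ¬pf′ = z≤n
    failure-≤-All-suffix []      β (_ ∷ α′) β′ refl pβ ¬pf′ = ⊥-elim (¬pf′ (All-middle α′ β′ pβ))
    failure-≤-All-suffix (_ ∷ α) β (_ ∷ α′) β′ eq pβ ¬pf′ =
      s≤s (failure-≤-All-suffix α β α′ β′ (∷-injectiveʳ eq) pβ ¬pf′)

    All-shorter-prefix : ∀ α β α′ β′ → α ++ f ∷ β ≡ α′ ++ f′ ∷ β′ →
      length α′ ≤ length α → All P α → All P α′
    All-shorter-prefix α       β []       β′ eq le pα = []
    All-shorter-prefix (_ ∷ α) β (_ ∷ α′) β′ eq (s≤s le) (pg ∷ pα) =
      subst P (∷-injectiveˡ eq) pg ∷ All-shorter-prefix α β α′ β′ (∷-injectiveʳ eq) le pα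

    All-longer-suffix : ∀ α β α′ β′ → α ++ f ∷ β ≡ α′ ++ f′ ∷ β′ →
      length α′ ≤ length α → All P β′ → All P β
    All-longer-suffix []      β [] β′ refl le pβ′ = pβ′
    All-longer-suffix (_ ∷ α) β [] β′ refl le pβ′ = All.tail (++⁻ʳ α pβ′)
    All-longer-suffix (_ ∷ α) β (_ ∷ α′) β′ eq (s≤s le) pβ′ =
      All-longer-suffix α β α′ β′ (∷-injectiveʳ eq) le pβ′

module Certificates {X : Set} (E A B : X → Set) where

  -- For E, A, B = _∈E T, EP₋ T, EP₊ o T these are definitionally
  -- MinusCert o T and PlusCert o T.
  Cert₋ Cert₊ : List X → ℕ → Set
  Cert₋ π k = (All A π × k ≡ suc (length π))
    ⊎ (∃[ α ] ∃[ f ] ∃[ β ] (π ≡ α ++ f ∷ β × k ≡ suc (length α)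
                             × All A α × (E f × ¬ A f) × All B β))
  Cert₊ π k = (All B π × k ≡ 0)
    ⊎ (∃[ α ] ∃[ f ] ∃[ β ] (π ≡ α ++ f ∷ β × k ≡ suc (length α)
                             × All A α × (E f × ¬ B f) × All B β))

  Cert₋⇒Cert₊ : Decidable B → ∀ {π k} → All E π → Cert₋ π k → ∃ (Cert₊ π)
  Cert₋⇒Cert₊ B? {π} es c₋ with last-failure B? π
  ... | inj₁ bπ = 0 , inj₁ (bπ , refl)
  ... | inj₂ (α′ , f′ , β′ , refl , ¬bf′ , bβ′) =
    suc (length α′) ,
    inj₂ (α′ , f′ , β′ , refl , refl , aα′ c₋ , (All-middle α′ β′ es , ¬bf′) , bβ′)
    where
    aα′ : ∀ {k} → Cert₋ (α′ ++ f′ ∷ β′) k → All A α′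
    aα′ (inj₁ (aπ , _)) = ++⁻ˡ α′ aπ
    aα′ (inj₂ (α , f , β , eq , _ , aα , _ , bβ)) =
      All-shorter-prefix α β α′ β′ (sym eq)
        (failure-≤-All-suffix α β α′ β′ (sym eq) bβ ¬bf′) aα

  Cert₊⇒Cert₋ : Decidable A → ∀ {π k} → All E π → Cert₊ π k → ∃ (Cert₋ π)
  Cert₊⇒Cert₋ A? {π} es c₊ with first-failure A? π
  ... | inj₁ aπ = suc (length π) , inj₁ (aπ , refl)
  ... | inj₂ (α , f , β , refl , aα , ¬af) =
    suc (length α) , inj₂ (α , f , β , refl , refl , aα , (All-middle α β es , ¬af) , bβ c₊)
    where
    bβ : ∀ {k} → Cert₊ (α ++ f ∷ β) k → All B β
    bβ (inj₁ (bπ , _)) = All.tail (++⁻ʳ α bπ)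
    bβ (inj₂ (α′ , f′ , β′ , eq , _ , aα′ , _ , bβ′)) =
      All-longer-suffix α β α′ β′ eq (All-prefix-≤-failure α β α′ β′ eq aα′ ¬af) bβ′

  Cert₊≤Cert₋ : ∀ {π k₋ k₊} → Cert₋ π k₋ → Cert₊ π k₊ → k₊ ≤ k₋
  Cert₊≤Cert₋ _ (inj₁ (_ , refl)) = z≤n
  Cert₊≤Cert₋ (inj₁ (_ , refl)) (inj₂ (α′ , _ , _ , refl , refl , _)) = s≤s (length-++-≤ˡ α′)
  Cert₊≤Cert₋ (inj₂ (α , f , β , refl , refl , _ , (_ , ¬af) , _))
              (inj₂ (α′ , f′ , β′ , eq , refl , aα′ , _)) =
    s≤s (All-prefix-≤-failure α β α′ β′ eq aα′ ¬af)

-- Finite search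

module _ {A : Set} {P : A → Set} where

  ∃?-within : (L : List A) → (∀ {x} → P x → x ∈ L) → Decidable P → Dec (∃ P)
  ∃?-within L bound P? =
    map′ Any.satisfied (λ (x , px) → Any.map (λ { refl → px }) (bound px)) (Any.any? P? L)

  ∀?-within : DecidableEquality A → (L : List A) → (∀ {x} → x ∉ L → P x) →
    Decidable P → Dec (∀ x → P x)
  ∀?-within _≟ᴬ_ L outside P? =
    map′ (λ pL x → extend pL x (Any.any? (x ≟ᴬ_) L)) (λ p → All.tabulate (λ {x} _ → p x))
      (All.all? P? L)
    where
    extend : All P L → ∀ x → Dec (x ∈ L) → P x
    extend pL x (yes x∈L) = All.lookup pL x∈L
    extend pL x (no x∉L) = outside x∉L

lists≤ : {A : Set} → List A → ℕ → List (List A)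
lists≤ xs zero    = [ [] ]
lists≤ xs (suc n) = [] ∷ concatMap (λ x → map (x ∷_) (lists≤ xs n)) xs

∈-lists≤ : {A : Set} {xs : List A} (n : ℕ) (ys : List A) →
  All (_∈ xs) ys → length ys ≤ n → ys ∈ lists≤ xs n
∈-lists≤ zero    []       _          _         = here refl
∈-lists≤ (suc n) []       _          _         = here refl
∈-lists≤ {xs = xs} (suc n) (y ∷ ys) (y∈ ∷ ys∈) (s≤s le) =
  there (∈-concat⁺′ (∈-map⁺ (y ∷_) (∈-lists≤ n ys ys∈ le))
                    (∈-map⁺ (λ x → map (x ∷_) (lists≤ xs n)) y∈))

_≟ˢ_ : DecidableEquality Str
_≟ˢ_ = List-≡-dec _≟_

Infix : Str → Str → Set
Infix x T = ∃[ u ] ∃[ w ] (u ++ x ++ w ≡ T)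

infixes : Str → List Str
infixes T = concatMap inits (tails T)

∈-inits : ∀ (u w : Str) → u ∈ inits (u ++ w)
∈-inits []      w = here refl
∈-inits (c ∷ u) w = there (∈-map⁺ (c ∷_) (∈-inits u w))

∈-tails : ∀ (u w : Str) → w ∈ tails (u ++ w)
∈-tails []      w = here refl
∈-tails (c ∷ u) w = there (∈-tails u w)

Infix⇒∈infixes : ∀ {x T} → Infix x T → x ∈ infixes T
Infix⇒∈infixes {x} (u , w , refl) = ∈-concat⁺′ (∈-inits x w) (∈-map⁺ inits (∈-tails u (x ++ w)))

≡⇒Infix : ∀ {x T} → x ≡ T → Infix x T
≡⇒Infix {x} eq = [] , [] , trans (++-identityʳ x) eq

Infix-++ˡ : ∀ {T} x y → Infix (x ++ y) T → Infix x T
Infix-++ˡ x y (u , w , eq) = u , y ++ w , trans (cong (u ++_) (sym (++-assoc x y w))) eq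

Infix-++ʳ : ∀ {T} x y → Infix (x ++ y) T → Infix y T
Infix-++ʳ x y (u , w , eq) =
  u ++ x , w , trans (++-assoc u x (y ++ w)) (trans (cong (u ++_) (sym (++-assoc x y w))) eq)

Infix-[_]⇒∈ : ∀ {T} a → Infix [ a ] T → a ∈ T
Infix-[ a ]⇒∈ (u , w , refl) = ∈-++⁺ʳ u (here refl)

module _ {P : Str → Set} (T : Str) where

  ∃?-Infix : (∀ {x} → P x → Infix x T) → Decidable P → Dec (∃ P)
  ∃?-Infix bound = ∃?-within (infixes T) (λ px → Infix⇒∈infixes (bound px))

  ∀?-Infix : (∀ {x} → ¬ Infix x T → P x) → Decidable P → Dec (∀ x → P x)
  ∀?-Infix outside =
    ∀?-within _≟ˢ_ (infixes T) (λ x∉ → outside (λ x-infix → x∉ (Infix⇒∈infixes x-infix)))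

right-maximal? : ∀ T x → Dec (RightMaximal T x)
right-maximal? T x =
  ∃?-Infix T (λ {u₁} (a , w₁ , _ , _ , _ , e₁ , _) → left u₁ a w₁ e₁) λ u₁ →
  ∃?-within T (λ {a} (w₁ , _ , _ , _ , e₁ , _) → Infix-[ a ]⇒∈ (symbol u₁ a w₁ e₁)) λ a →
  ∃?-Infix T (λ {w₁} (_ , _ , _ , e₁ , _) → right u₁ a w₁ e₁) λ w₁ →
  ∃?-Infix T (λ {u₂} (b , w₂ , _ , e₂ , _) → left u₂ b w₂ e₂) λ u₂ →
  ∃?-within T (λ {b} (w₂ , _ , e₂ , _) → Infix-[ b ]⇒∈ (symbol u₂ b w₂ e₂)) λ b →
  ∃?-Infix T (λ {w₂} (_ , e₂ , _) → right u₂ b w₂ e₂) λ w₂ →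
  ((u₁ ++ x ++ a ∷ w₁) ≟ˢ T) ×-dec ((u₂ ++ x ++ b ∷ w₂) ≟ˢ T) ×-dec ¬? (a ≟ b)
  where
  module _ u a w (e : u ++ x ++ a ∷ w ≡ T) where
    after : Infix (a ∷ w) T
    after = Infix-++ʳ x _ (Infix-++ʳ u _ (≡⇒Infix e))
    left : Infix u T
    left = Infix-++ˡ u _ (≡⇒Infix e)
    symbol : Infix [ a ] T
    symbol = Infix-++ˡ [ a ] w after
    right : Infix w T
    right = Infix-++ʳ [ a ] w after

infix? : ∀ x T → Dec (Infix x T)
infix? x T =
  ∃?-Infix T (λ {u} (w , e) → Infix-++ˡ u _ (≡⇒Infix e)) λ u →
  ∃?-Infix T (λ {w} e → Infix-++ʳ x w (Infix-++ʳ u _ (≡⇒Infix e))) λ w →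
  (u ++ x ++ w) ≟ˢ T

prefix? : ∀ x T → Dec (∃[ w ] (x ++ w ≡ T))
prefix? x T = ∃?-Infix T (λ {w} e → Infix-++ʳ x w (≡⇒Infix e)) λ w → (x ++ w) ≟ˢ T

suffix? : ∀ x T → Dec (∃[ u ] (u ++ x ≡ T))
suffix? x T = ∃?-Infix T (λ {u} e → Infix-++ˡ u x (≡⇒Infix e)) λ u → (u ++ x) ≟ˢ T

left-maximal? : ∀ T x → Dec (LeftMaximal T x)
left-maximal? T x =
  prefix? x T ⊎-dec
  (∃?-Infix T (λ {u₁} (a , w₁ , _ , _ , _ , e₁ , _) → left u₁ a w₁ e₁) λ u₁ →
   ∃?-within T (λ {a} (w₁ , _ , _ , _ , e₁ , _) → Infix-[ a ]⇒∈ (symbol u₁ a w₁ e₁)) λ a →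
   ∃?-Infix T (λ {w₁} (_ , _ , _ , e₁ , _) → right u₁ a w₁ e₁) λ w₁ →
   ∃?-Infix T (λ {u₂} (b , w₂ , _ , e₂ , _) → left u₂ b w₂ e₂) λ u₂ →
   ∃?-within T (λ {b} (w₂ , _ , e₂ , _) → Infix-[ b ]⇒∈ (symbol u₂ b w₂ e₂)) λ b →
   ∃?-Infix T (λ {w₂} (_ , e₂ , _) → right u₂ b w₂ e₂) λ w₂ →
   ((u₁ ++ a ∷ x ++ w₁) ≟ˢ T) ×-dec ((u₂ ++ b ∷ x ++ w₂) ≟ˢ T) ×-dec ¬? (a ≟ b))
  where
  module _ u a w (e : u ++ a ∷ x ++ w ≡ T) where
    after : Infix (a ∷ x ++ w) T
    after = Infix-++ʳ u _ (≡⇒Infix e)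
    left : Infix u T
    left = Infix-++ˡ u _ (≡⇒Infix e)
    symbol : Infix [ a ] T
    symbol = Infix-++ˡ [ a ] (x ++ w) after
    right : Infix w T
    right = Infix-++ʳ x w (Infix-++ʳ [ a ] (x ++ w) after)

node? : ∀ T x → Dec (IsNode T x)
node? T x = (x ≟ˢ []) ⊎-dec (x ≟ˢ T) ⊎-dec (right-maximal? T x ×-dec left-maximal? T x)

nonempty? : ∀ (l : Str) → Dec (∃[ c ] ∃[ β ] (l ≡ c ∷ β))
nonempty? []      = no λ ()
nonempty? (c ∷ β) = yes (c , β , refl)

edge? : ∀ T e → Dec (IsEdge T e)
edge? T (x , l , y) =
  node? T x ×-dec node? T y ×-dec nonempty? l ×-dec infix? (x ++ l) T
  ×-dec (right-maximal? T (x ++ l) ⊎-dec suffix? (x ++ l) T)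
  ×-dec branch-free? ×-dec target? ×-dec extends?
  where
  branch-free? : Dec (∀ p q → l ≡ p ++ q → p ≢ [] → q ≢ [] → ¬ RightMaximal T (x ++ p))
  branch-free? =
    ∀?-Infix l (λ {p} ¬p-infix q e → ⊥-elim (¬p-infix (Infix-++ˡ p q (≡⇒Infix (sym e))))) λ p →
    ∀?-Infix l (λ {q} ¬q-infix e → ⊥-elim (¬q-infix (Infix-++ʳ p q (≡⇒Infix (sym e))))) λ q →
    (l ≟ˢ (p ++ q)) →-dec ¬? (p ≟ˢ []) →-dec ¬? (q ≟ˢ []) →-dec ¬? (right-maximal? T (x ++ p))
  target? : Dec (∃[ α ] (y ≡ α ++ x ++ l))
  target? = map′ (λ (α , e) → α , sym e) (λ (α , e) → α , sym e) (suffix? (x ++ l) y)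
  extends? : Dec (∀ u w → u ++ (x ++ l) ++ w ≡ T → ∃[ u′ ] (u′ ++ y ++ w ≡ T))
  extends? =
    ∀?-Infix T (λ {u} ¬u-infix w e → ⊥-elim (¬u-infix (Infix-++ˡ u _ (≡⇒Infix e)))) λ u →
    ∀?-Infix T (λ {w} ¬w-infix e →
                  ⊥-elim (¬w-infix (Infix-++ʳ (x ++ l) w (Infix-++ʳ u _ (≡⇒Infix e))))) λ w →
    ((u ++ (x ++ l) ++ w) ≟ˢ T) →-dec suffix? (y ++ w) T

-- Paths are short

node-Infix : ∀ {T x} → IsNode T x → Infix x T
node-Infix {T}     (inj₁ refl)        = [] , T , refl
node-Infix         (inj₂ (inj₁ refl)) = ≡⇒Infix refl
node-Infix {x = x} (inj₂ (inj₂ ((u , a , w , _ , _ , _ , e , _) , _))) =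
  Infix-++ˡ x (a ∷ w) (Infix-++ʳ u _ (≡⇒Infix e))

candidate-edges : Str → List Edge
candidate-edges T = cartesianProduct (infixes T) (cartesianProduct (infixes T) (infixes T))

candidate-paths : Str → ℕ → List (List Edge)
candidate-paths T = lists≤ (candidate-edges T)

edge∈candidates : ∀ {T e} → IsEdge T e → e ∈ candidate-edges T
edge∈candidates {T} {x , l , y} (x-node , y-node , _ , xl-infix , _) =
  ∈-cartesianProduct⁺ (Infix⇒∈infixes (node-Infix x-node))
    (∈-cartesianProduct⁺ (Infix⇒∈infixes (Infix-++ʳ x l xl-infix))
                         (Infix⇒∈infixes (node-Infix y-node)))

edge-lengthens : ∀ {T e} → IsEdge T e → length (src e) < length (tgt e)
edge-lengthens {e = x , l , y} (_ , _ , (c , β , refl) , _ , _ , _ , (α , refl) , _) = begin-strict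
  length x                 <⟨ s≤s (length-++-≤ˡ x) ⟩
  suc (length (x ++ β))    ≡⟨ length-++-sucʳ x c β ⟨
  length (x ++ c ∷ β)      ≤⟨ length-++-≤ʳ (x ++ c ∷ β) {α} ⟩
  length (α ++ x ++ c ∷ β) ∎
  where open ≤-Reasoning

path-length≤ : ∀ {T v w π} → PathFromTo T v w π → length π ≤ length w
path-length≤ {π = π} (edges , linked) = ≤-trans (m≤m+n (length π) _) (path-length+ edges linked)
  where
  path-length+ : ∀ {T v w π} → All (_∈E T) π → Linked v w π → length π + length v ≤ length w
  path-length+ []                refl = ≤-refl
  path-length+ {w = w} {e ∷ π} (edge ∷ edges) (refl , linked) = begin
    suc (length π + length (src e)) ≡⟨ +-suc (length π) _ ⟨
    length π + suc (length (src e)) ≤⟨ +-monoʳ-≤ (length π) (edge-lengthens edge) ⟩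
    length π + length (tgt e)       ≤⟨ path-length+ edges linked ⟩
    length w                        ∎
    where open ≤-Reasoning

path∈candidates : ∀ {T v w π} → PathFromTo T v w π → π ∈ candidate-paths T (length w)
path∈candidates {π = π} path@(edges , _) =
  ∈-lists≤ _ π (All.map edge∈candidates edges) (path-length≤ path)

path-init∈candidates : ∀ {T v w π e} → PathFromTo T v w (π ++ [ e ]) → π ∈ candidate-paths T (length w)
path-init∈candidates {π = π} path@(edges , _) =
  ∈-lists≤ _ π (All.map edge∈candidates (++⁻ˡ π edges)) (≤-trans (length-++-≤ˡ π) (path-length≤ path))

path-tail∈candidates : ∀ {T v w π e} → PathFromTo T v w (e ∷ π) → π ∈ candidate-paths T (length w)
path-tail∈candidates {π = π} path@(_ ∷ edges , _) =
  ∈-lists≤ _ π (All.map edge∈candidates edges) (≤-trans (n≤1+n _) (path-length≤ path))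

linked? : ∀ v w π → Dec (Linked v w π)
linked? v w []      = v ≟ˢ w
linked? v w (e ∷ π) = (src e ≟ˢ v) ×-dec linked? (tgt e) w π

path? : ∀ T v w π → Dec (PathFromTo T v w π)
path? T v w π = All.all? (edge? T) π ×-dec linked? v w π

Spelled : Str → Str → Str → Str → Set
Spelled T v w X = ∃[ π ] (PathFromTo T v w π × spell π ≡ X)

spelled? : ∀ T v w X → Dec (Spelled T v w X)
spelled? T v w X =
  ∃?-within (candidate-paths T (length w)) (λ (path , _) → path∈candidates path) λ π →
  path? T v w π ×-dec (spell π ≟ˢ X)

_≟ᵉ_ : DecidableEquality Edge
_≟ᵉ_ = ×-≡-dec _≟ˢ_ (×-≡-dec _≟ˢ_ _≟ˢ_)

all-spelled? : ∀ T v w {R : Str → Set} → Decidable R → Dec (∀ Y → Spelled T v w Y → R Y)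
all-spelled? T v w {R} R? =
  map′ (λ h Y (π , p , eq) → subst R eq (h π p)) (λ h π p → h (spell π) (π , p , refl))
    (∀?-within (List-≡-dec _≟ᵉ_) (candidate-paths T (length w))
      (λ π∉ path → ⊥-elim (π∉ (path∈candidates path))) λ π →
     path? T v w π →-dec R? (spell π))

minimum? : {_⪯_ : Str → Str → Set} → (∀ X Y → Dec (X ⪯ Y)) →
  ∀ T v w X → Dec (IsMin _⪯_ (Spelled T v w) X)
minimum? ⪯? T v w X = spelled? T v w X ×-dec all-spelled? T v w (⪯? X)

≤pos? : ∀ X Y → Dec (X ≤pos Y)
≤pos? X Y = length Y ≤? length X

order? : ∀ o X Y → Dec (⟦ o ⟧ X Y)
order? lexOrd = Lex.≤-decidable _≟_ _<?_
order? posOrd = ≤pos?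

EP₋? : ∀ T e → Dec (EP₋ T e)
EP₋? T e =
  edge? T e ×-dec
  ∃?-within (candidate-paths T (length (tgt e))) (λ (path , _) → path-init∈candidates path) λ π →
  path? T root (tgt e) (π ++ [ e ]) ×-dec minimum? ≤pos? T root (tgt e) (spell (π ++ [ e ]))

EP₊? : ∀ o T e → Dec (EP₊ o T e)
EP₊? o T e =
  edge? T e ×-dec
  ∃?-within (candidate-paths T (length T)) (λ (path , _) → path-tail∈candidates path) λ π →
  path? T (src e) T (e ∷ π) ×-dec minimum? (order? o) T (src e) T (spell (e ∷ π))

lemma3 : (T : Str) → EndMarked T → (o : PlusOrder)
  → (S : Str) → ∃[ u ] (u ++ S ≡ T)
  → (π : List Edge) → PathFromTo T root (sink T) π → spell π ≡ S
  → (MinusCanonical o T π ⇔ PlusCanonical o T π)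
    × (∀ k₋ k₊ → MinusCert o T π k₋ → PlusCert o T π k₊
        → k₊ ≤ k₋
          × (1 ≤ k₊ → k₋ ≤ length π → 1 ≤ k₊ × k₊ ≤ k₋ × k₋ ≤ length π))
lemma3 T _ o _ _ π (edges , _) _ =
  mk⇔ (λ (_ , c₋) → Cert₋⇒Cert₊ (EP₊? o T) edges c₋)
      (λ (_ , c₊) → Cert₊⇒Cert₋ (EP₋? T) edges c₊) ,
  λ k₋ k₊ c₋ c₊ → let k₊≤k₋ = Cert₊≤Cert₋ c₋ c₊ in
    k₊≤k₋ , λ 1≤k₊ k₋≤ℓ → 1≤k₊ , k₊≤k₋ , k₋≤ℓ
  where open Certificates (_∈E T) (EP₋ T) (EP₊ o T)
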